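{- Let $\mathbf A=(A,\wedge,\vee,\neg,0,1)$ be a bounded involutive lattice, and define $x\cdot y := x\wedge(\neg x\vee y)$ and $x\Rightarrow y := \neg x\vee(x\wedge y)$ for $x,y\in A$. The following are equivalent: (1) there exists a binary operation $\backslash$ on $A$ such that for all $x,y,z\in A$, $x\cdot y\le z \iff y\le x\backslash z$; (2) there exists a binary operation $\odot$ on $A$ such that for all $x,y,z\in A$, $y\le x\Rightarrow z \iff x\odot y\le z$. Moreover, if $\mathbf A$ satisfies these equivalent conditions, then $\mathbf A$ is an ortholattice, i.e., $x\wedge\neg x=0$ for all $x\in A$.
   Context: A bounded involutive lattice is a bounded lattice $(A,\wedge,\vee,0,1)$ equipped with an order-reversing involution $\neg$ (so $\neg\neg x=x$ and $x\le y$ implies $\neg y\le\neg x$). An ortholattice is a bounded involutive lattice satisfying $x\wedge\neg x\approx 0$ (equivalently $x\vee\neg x\approx 1$). The operation $\cdot$ is the Sasaki product and $\Rightarrow$ the Sasaki hook. -}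

module Defs where

open import Level using (Level; suc; _⊔_)
open import Relation.Binary.Core using (Rel)
open import Algebra.Core using (Op₁; Op₂)
open import Algebra.Lattice.Structures using (IsLattice)
open import Data.Product using () renaming (Σ to Σ'; _×_ to _×'_)

record BoundedInvolutiveLattice (c ℓ : Level) : Set (suc (c ⊔ ℓ)) where
  infixr 7 _∧_
  infixr 6 _∨_
  infix  4 _≈_ _≤_
  field
    Carrier   : Set c
    _≈_       : Rel Carrier ℓ
    _∨_       : Op₂ Carrier
    _∧_       : Op₂ Carrier
    ¬_        : Op₁ Carrier
    ⊥         : Carrier
    ⊤         : Carrier
    isLattice : IsLattice _≈_ _∨_ _∧_

  _≤_ : Rel Carrier ℓ
  x ≤ y = (x ∧ y) ≈ x

  field
    ⊥-minimum  : ∀ x → ⊥ ≤ x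
    ⊤-maximum  : ∀ x → x ≤ ⊤
    ¬-cong     : ∀ {x y} → x ≈ y → (¬ x) ≈ (¬ y)
    ¬-involutive : ∀ x → (¬ (¬ x)) ≈ x
    ¬-antitone : ∀ {x y} → x ≤ y → (¬ y) ≤ (¬ x)

  open IsLattice isLattice public

  infixl 8 _·_
  infixr 5 _⇒_
  _·_ : Op₂ Carrier
  x · y = x ∧ ((¬ x) ∨ y)

  _⇒_ : Op₂ Carrier
  x ⇒ y = (¬ x) ∨ (x ∧ y)

  HasRightResidual : Set (c ⊔ ℓ)
  HasRightResidual =
    Σ' (Op₂ Carrier) λ _\\_ → ∀ x y z → ((x · y ≤ z) → (y ≤ x \\ z)) ×' ((y ≤ x \\ z) → (x · y ≤ z))

  HasLeftAdjoint : Set (c ⊔ ℓ)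
  HasLeftAdjoint =
    Σ' (Op₂ Carrier) λ _⊙_ → ∀ x y z → ((y ≤ x ⇒ z) → (x ⊙ y ≤ z)) ×' ((x ⊙ y ≤ z) → (y ≤ x ⇒ z))

  IsOrtholattice : Set (c ⊔ ℓ)
  IsOrtholattice = ∀ x → (x ∧ (¬ x)) ≈ ⊥

-- Negation turns the Sasaki product into the Sasaki hook: x ⇒ z ≈ ¬ (x · ¬ z) and
-- x · y ≈ ¬ (x ⇒ ¬ y).  Since ¬ is an order-reversing involution, a ≤ ¬ b ⇔ b ≤ ¬ a,
-- so a right residual \ of · yields the left adjoint x ⊙ y := ¬ (x \ ¬ y) of ⇒, and
-- symmetrically x \ z := ¬ (x ⊙ ¬ z).  Finally, residuation forces x · ⊥ ≤ ⊥, while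
-- x ∧ ¬ x ≤ x ∧ (¬ x ∨ ⊥) = x · ⊥.
{-# OPTIONS --safe #-}
module Submission where

open import Defs
open import Level using (Level; _⊔_)
open import Data.Product using (_×_; _,_; proj₁; proj₂)
open import Function.Bundles using (_⇔_; mk⇔)
open import Algebra.Core using (Op₂)
open import Algebra.Lattice.Bundles using (Lattice)
import Algebra.Lattice.Properties.Lattice as LatticeProperties
import Relation.Binary.Lattice as OrderTheoretic

module BoundedInvolutiveLatticeProperties {c ℓ : Level} (A : BoundedInvolutiveLattice c ℓ) where
  open BoundedInvolutiveLattice A

  private
    lattice : Lattice c ℓ
    lattice = record { isLattice = isLattice }

    -- The library's natural order is x ≈ x ∧ y, the symmetric form of _≤_.
    module Order = OrderTheoretic.IsLattice (LatticeProperties.∨-∧-isOrderTheoreticLattice lattice)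

  open import Relation.Binary.Reasoning.Setoid (Lattice.setoid lattice)

  ≤-trans : ∀ {x y z} → x ≤ y → y ≤ z → x ≤ z
  ≤-trans p q = sym (Order.trans (sym p) (sym q))

  ≤-reflexive : ∀ {x y} → x ≈ y → x ≤ y
  ≤-reflexive p = sym (Order.reflexive p)

  ≤-antisym : ∀ {x y} → x ≤ y → y ≤ x → x ≈ y
  ≤-antisym p q = Order.antisym (sym p) (sym q)

  x∧y≤x : ∀ x y → x ∧ y ≤ x
  x∧y≤x x y = sym (Order.x∧y≤x x y)

  x∧y≤y : ∀ x y → x ∧ y ≤ y
  x∧y≤y x y = sym (Order.x∧y≤y x y)

  ∧-greatest : ∀ {x y z} → x ≤ y → x ≤ z → x ≤ y ∧ z
  ∧-greatest p q = sym (Order.∧-greatest (sym p) (sym q))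

  x≤x∨y : ∀ x y → x ≤ x ∨ y
  x≤x∨y x y = sym (Order.x≤x∨y x y)

  y≤x∨y : ∀ x y → y ≤ x ∨ y
  y≤x∨y x y = sym (Order.y≤x∨y x y)

  ∨-least : ∀ {x y z} → x ≤ z → y ≤ z → x ∨ y ≤ z
  ∨-least p q = sym (Order.∨-least (sym p) (sym q))

  ≤-respˡ-≈ : ∀ {x y z} → x ≈ y → y ≤ z → x ≤ z
  ≤-respˡ-≈ p = ≤-trans (≤-reflexive p)

  ≤-respʳ-≈ : ∀ {x y z} → y ≈ z → x ≤ y → x ≤ z
  ≤-respʳ-≈ p q = ≤-trans q (≤-reflexive p)

  ¬-swapˡ : ∀ {x y} → ¬ x ≤ y → ¬ y ≤ x
  ¬-swapˡ p = ≤-respʳ-≈ (¬-involutive _) (¬-antitone p)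

  ¬-swapʳ : ∀ {x y} → x ≤ ¬ y → y ≤ ¬ x
  ¬-swapʳ p = ≤-respˡ-≈ (sym (¬-involutive _)) (¬-antitone p)

  ¬-∨ : ∀ x y → ¬ (x ∨ y) ≈ ¬ x ∧ ¬ y
  ¬-∨ x y = ≤-antisym
    (∧-greatest (¬-antitone (x≤x∨y x y)) (¬-antitone (y≤x∨y x y)))
    (¬-swapʳ (∨-least (¬-swapʳ (x∧y≤x _ _)) (¬-swapʳ (x∧y≤y _ _))))

  ¬-∧ : ∀ x y → ¬ (x ∧ y) ≈ ¬ x ∨ ¬ y
  ¬-∧ x y = begin
    ¬ (x ∧ y)             ≈⟨ ¬-cong (∧-cong (¬-involutive x) (¬-involutive y)) ⟨
    ¬ (¬ ¬ x ∧ ¬ ¬ y)     ≈⟨ ¬-cong (¬-∨ (¬ x) (¬ y)) ⟨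
    ¬ ¬ (¬ x ∨ ¬ y)       ≈⟨ ¬-involutive _ ⟩
    ¬ x ∨ ¬ y             ∎

  ·-as-¬⇒¬ : ∀ x y → x · y ≈ ¬ (x ⇒ ¬ y)
  ·-as-¬⇒¬ x y = begin
    x ∧ (¬ x ∨ y)              ≈⟨ ∧-cong (¬-involutive x) (∨-congˡ (¬-involutive y)) ⟨
    ¬ ¬ x ∧ (¬ x ∨ ¬ ¬ y)      ≈⟨ ∧-congˡ (¬-∧ x (¬ y)) ⟨
    ¬ ¬ x ∧ ¬ (x ∧ ¬ y)        ≈⟨ ¬-∨ (¬ x) (x ∧ ¬ y) ⟨
    ¬ (¬ x ∨ (x ∧ ¬ y))        ∎

  ⇒-as-¬·¬ : ∀ x z → x ⇒ z ≈ ¬ (x · ¬ z)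
  ⇒-as-¬·¬ x z = begin
    ¬ x ∨ (x ∧ z)              ≈⟨ ¬-involutive _ ⟨
    ¬ ¬ (¬ x ∨ (x ∧ z))        ≈⟨ ¬-cong (¬-cong (∨-congˡ (∧-congˡ (¬-involutive z)))) ⟨
    ¬ ¬ (¬ x ∨ (x ∧ ¬ ¬ z))    ≈⟨ ¬-cong (·-as-¬⇒¬ x (¬ z)) ⟨
    ¬ (x · ¬ z)                ∎

  RightResidual : Op₂ Carrier → Op₂ Carrier → Set (c ⊔ ℓ)
  RightResidual _∘_ _\\_ = ∀ x y z → ((x ∘ y ≤ z) → (y ≤ x \\ z)) × ((y ≤ x \\ z) → (x ∘ y ≤ z))

  LeftAdjoint : Op₂ Carrier → Op₂ Carrier → Set (c ⊔ ℓ)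
  LeftAdjoint _⇛_ _⊙_ = ∀ x y z → ((y ≤ x ⇛ z) → (x ⊙ y ≤ z)) × ((x ⊙ y ≤ z) → (y ≤ x ⇛ z))

  rightResidual⇒leftAdjoint : ∀ {_∘_ _⇛_ _\\_} → (∀ x z → x ⇛ z ≈ ¬ (x ∘ (¬ z))) →
                              RightResidual _∘_ _\\_ → LeftAdjoint _⇛_ (λ x y → ¬ (x \\ (¬ y)))
  rightResidual⇒leftAdjoint ⇛-dual residual x y z =
    (λ y≤x⇛z → ¬-swapˡ (proj₁ (residual x (¬ z) (¬ y)) (¬-swapʳ (≤-respʳ-≈ (⇛-dual x z) y≤x⇛z)))) ,
    (λ ⊙≤z → ≤-respʳ-≈ (sym (⇛-dual x z)) (¬-swapʳ (proj₂ (residual x (¬ z) (¬ y)) (¬-swapˡ ⊙≤z))))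

  leftAdjoint⇒rightResidual : ∀ {_∘_ _⇛_ _⊙_} → (∀ x y → x ∘ y ≈ ¬ (x ⇛ (¬ y))) →
                              LeftAdjoint _⇛_ _⊙_ → RightResidual _∘_ (λ x z → ¬ (x ⊙ (¬ z)))
  leftAdjoint⇒rightResidual ∘-dual adjoint x y z =
    (λ ∘≤z → ¬-swapʳ (proj₁ (adjoint x (¬ z) (¬ y)) (¬-swapˡ (≤-respˡ-≈ (sym (∘-dual x y)) ∘≤z)))) ,
    (λ y≤\\ → ≤-respˡ-≈ (∘-dual x y) (¬-swapˡ (proj₂ (adjoint x (¬ z) (¬ y)) (¬-swapʳ y≤\\))))

  rightResidual⇒∘⊥≤⊥ : ∀ {_∘_ _\\_} → RightResidual _∘_ _\\_ → ∀ x → x ∘ ⊥ ≤ ⊥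
  rightResidual⇒∘⊥≤⊥ residual x = proj₂ (residual x ⊥ ⊥) (⊥-minimum _)

  x∧¬x≤x·⊥ : ∀ x → x ∧ ¬ x ≤ x · ⊥
  x∧¬x≤x·⊥ x = ∧-greatest (x∧y≤x _ _) (≤-trans (x∧y≤y _ _) (x≤x∨y (¬ x) ⊥))

  ·-residuated⇒ortho : ∀ {_\\_} → RightResidual _·_ _\\_ → IsOrtholattice
  ·-residuated⇒ortho residual x =
    ≤-antisym (≤-trans (x∧¬x≤x·⊥ x) (rightResidual⇒∘⊥≤⊥ residual x)) (⊥-minimum _)

proposition2p1 : ∀ {c ℓ : Level} (A : BoundedInvolutiveLattice c ℓ) → let open BoundedInvolutiveLattice A in (HasRightResidual ⇔ HasLeftAdjoint) × (HasRightResidual → IsOrtholattice)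
proposition2p1 A =
  mk⇔ (λ (_ , residual) → _ , rightResidual⇒leftAdjoint ⇒-as-¬·¬ residual)
      (λ (_ , adjoint) → _ , leftAdjoint⇒rightResidual ·-as-¬⇒¬ adjoint) ,
  λ (_ , residual) → ·-residuated⇒ortho residual
  where open BoundedInvolutiveLatticeProperties A
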